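{- The back stable slides $\overleftarrow{\mathfrak{F}}_{\mathbf c}$, as $\mathbf c$ ranges over all $\mathbb{N}$-vectors, form a $\mathbb{Q}$-basis of the space $\overleftarrow{QR}$ of back quasisymmetric functions.
   Context: Variables $\mathbf{x}=\{x_i: i\in\mathbb{Z}\}$. An $\mathbb{N}$-vector is a sequence $\mathbf c=(c_i)_{i\in\mathbb{Z}}$ of nonnegative integers with finitely many nonzero entries. Let $R\subseteq\mathbb{Q}[[\mathbf x]]$ be the set of formal power series of bounded degree in which, for some $N\in\mathbb{Z}$, no $x_i$ with $i>N$ appears. An $f\in R$ is back quasisymmetric if there is $b\in\mathbb{Z}$ such that for every sequence of positive integers $(a_1,\dots,a_k)$ and every monomial $\mathsf m$ in the variables $x_i$, $i>b$, the coefficient of $x_{i_1}^{a_1}\cdots x_{i_k}^{a_k}\mathsf m$ in $f$ equals that of $x_{j_1}^{a_1}\cdots x_{j_k}^{a_k}\mathsf m$ whenever $i_1<\cdots<i_k\le b$ and $j_1<\cdots<j_k\le b$. $\overleftarrow{QR}$ denotes the $\mathbb{Q}$-vector space of back quasisymmetric functions. For an $\mathbb{N}$-vector $\mathbf c$, let $r=\sum_i c_i$ and let $D_1\ge D_2\ge\cdots\ge D_r$ be the nonincreasing word in which each integer $i$ appears exactly $c_i$ times. The back stable slide is \[ \overleftarrow{\mathfrak{F}}_{\mathbf c}=\sum x_{i_1}\cdots x_{i_r}, \] summed over all integer sequences $i_1\ge\cdots\ge i_r$ with $i_k\le D_k$ for all $k$ and $i_k>i_{k+1}$ whenever $D_k>D_{k+1}$.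 -}

module Defs where

open import Data.Bool using (Bool; true; false; _∧_; _∨_; not; if_then_else_)
open import Data.Nat as ℕ using (ℕ)
open import Data.Integer as ℤ using (ℤ)
open import Data.Rational as ℚ using (ℚ; 0ℚ; 1ℚ)
open import Data.List using (List; []; _∷_; _++_; length; reverse; concat; replicate)
open import Data.List.Relation.Unary.Linked using (Linked)
open import Data.List.Relation.Unary.All using (All)
open import Data.List.Relation.Unary.Any using (Any)
open import Data.Vec as Vec using (Vec)
open import Data.Product using (Σ; ∃; _×_; _,_)
open import Relation.Nullary.Decidable using (⌊_⌋)
open import Relation.Binary.PropositionalEquality using (_≡_)

Nonincreasing : List ℤ → Set
Nonincreasing = Linked (λ a b → b ℤ.≤ a)

-- A monomial x_{i₁}⋯x_{i_r} is encoded by its unique nonincreasing word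
-- (i₁ ≥ ⋯ ≥ i_r).  An ℕ-vector c is encoded by the nonincreasing word
-- D₁ ≥ ⋯ ≥ D_r in which each i appears exactly c_i times.
-- A formal power series in x = {x_i : i ∈ ℤ} over ℚ is its coefficient
-- function on monomials; values on non-nonincreasing lists are irrelevant.
Series : Set
Series = List ℤ → ℚ

_≈ₛ_ : Series → Series → Set
f ≈ₛ g = ∀ w → Nonincreasing w → f w ≡ g w

InR : Series → Set
InR f = (∃ λ d → ∀ w → Nonincreasing w → d ℕ.< length w → f w ≡ 0ℚ)
      × (∃ λ N → ∀ w → Nonincreasing w → Any (N ℤ.<_) w → f w ≡ 0ℚ)

-- nonincreasing word of x_{i₁}^{a₁}⋯x_{i_k}^{a_k} when i₁ < ⋯ < i_k
block : ∀ {k} → Vec ℕ k → Vec ℤ k → List ℤ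
block a is = reverse (concat (Vec.toList (Vec.zipWith replicate a is)))

StrictlyIncreasing : ∀ {k} → Vec ℤ k → Set
StrictlyIncreasing is = Linked ℤ._<_ (Vec.toList is)

BackQsym : Series → Set
BackQsym f = ∃ λ b → ∀ k (a : Vec ℕ k) → All (0 ℕ.<_) (Vec.toList a)
  → (m : List ℤ) → Nonincreasing m → All (b ℤ.<_) m
  → (is js : Vec ℤ k)
  → StrictlyIncreasing is → All (ℤ._≤ b) (Vec.toList is)
  → StrictlyIncreasing js → All (ℤ._≤ b) (Vec.toList js)
  → f (m ++ block a is) ≡ f (m ++ block a js)

InQR : Series → Set
InQR f = InR f × BackQsym f

slideOK : List ℤ → List ℤ → Bool
slideOK [] [] = true
slideOK (i ∷ []) (d ∷ []) = i ℤ.≤ᵇ d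
slideOK (i ∷ i' ∷ is) (d ∷ d' ∷ ds) =
  (i ℤ.≤ᵇ d) ∧ (not ⌊ d' ℤ.<? d ⌋ ∨ ⌊ i' ℤ.<? i ⌋) ∧ slideOK (i' ∷ is) (d' ∷ ds)
slideOK _ _ = false

-- back stable slide indexed by the word D of an ℕ-vector c
-- (each monomial occurs with coefficient 0 or 1, since the summation
-- runs over nonincreasing index sequences)
backSlide : List ℤ → Series
backSlide D w = if slideOK w D then 1ℚ else 0ℚ

linComb : List (ℚ × List ℤ) → Series
linComb [] w = 0ℚ
linComb ((q , D) ∷ t) w = q ℚ.* backSlide D w ℚ.+ linComb t w

zeroS : Series
zeroS _ = 0ℚ

-- If F_D(w) ≠ 0 then w ≤ D entrywise, so the slides are unitriangular with respect to the total
-- of a word: evaluating a combination of slides at a word of maximal total isolates a single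
-- coefficient. This gives linear independence, and solves f = Σ c_D F_D on any finite set of words.
--
-- Call D flat for b if its entries ≤ b run down from b without gaps. For flat D the bounds i ≤ D_k
-- at letters i ≤ b follow from the strictness conditions, so F_D only sees which neighbouring
-- letters ≤ b are equal: F_D is back quasisymmetric with bound b. Back quasisymmetry of f with
-- bound b moves every monomial to one whose letters ≤ b are b, b-1, …, b-k+1 with the original
-- multiplicities, a flat word. In bounded degree and support there are finitely many such words;
-- f agrees on them with the combination of their slides solving the triangular system, and both
-- sides are back quasisymmetric with bound b, so they agree everywhere.

module Submission where

open import Defs
open import Data.Bool using (Bool; true; false; T; _∧_; _∨_; not; if_then_else_)
open import Data.Bool.Properties using (∨-zeroʳ; ∨-inverseˡ; T-∧; T-≡)
open import Data.Nat as ℕ using (ℕ; zero; suc)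
import Data.Nat.Properties as ℕP
open import Data.Nat.Induction using (<-wellFounded)
open import Data.Integer as ℤ using (ℤ; 0ℤ; 1ℤ; +_; _≤_; _<_; _≤?_; _<?_; _≤ᵇ_)
import Data.Integer.Properties as ℤP
open import Data.Integer.Tactic.RingSolver using (solve-∀)
open import Data.Rational as ℚ using (ℚ; 0ℚ; 1ℚ)
import Data.Rational.Properties as ℚP
open import Data.Rational.Solver using (module +-*-Solver)
open import Data.Product using (Σ; ∃; _×_; _,_; proj₁; proj₂)
open import Data.Sum using (_⊎_; inj₁; inj₂)
open import Data.Vec as Vec using (Vec; []; _∷_)
open import Data.List
  using (List; []; _∷_; _++_; [_]; foldr; map; filter; length; reverse; reverseAcc; replicate; concat;
         cartesianProductWith)
open import Data.List.Properties
  using (≡-dec; ++-assoc; ++-identityʳ; length-++; length-replicate; filter-notAll;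
         reverse-++; reverse-involutive; unfold-reverse)
open import Data.List.Extrema ℤP.≤-totalOrder
  using (argmax; argmax-sel; f[xs]≤f[argmax]; f[⊥]≤f[argmax]; max; xs≤max; min; min≤xs)
open import Data.List.Membership.Propositional using (_∈_)
open import Data.List.Membership.Propositional.Properties
  using (∈-cartesianProductWith⁺; ∈-map⁺; ∈-filter⁺; ∈-filter⁻)
open import Data.List.Relation.Binary.Pointwise using (Pointwise; []; _∷_; Pointwise-length)
open import Data.List.Relation.Unary.All as All using (All; []; _∷_)
import Data.List.Relation.Unary.All.Properties as AllP
open import Data.List.Relation.Unary.AllPairs using ([]; _∷_)
import Data.List.Relation.Unary.AllPairs.Properties as APP
open import Data.List.Relation.Unary.Any as Any using (Any; here; there)
open import Data.List.Relation.Unary.Linked as Linked using (Linked; []; [-]; _∷_; linked?)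
open import Data.List.Relation.Unary.Linked.Properties using (Linked⇒All)
open import Data.List.Relation.Unary.Unique.Propositional using (Unique)
open import Function using (flip; _∘_)
open import Function.Bundles using (Equivalence)
open import Induction.WellFounded using (Acc; acc)
open import Relation.Binary.Definitions using (Reflexive; Transitive)
open import Relation.Nullary using (¬_; ¬?; Dec; yes; no)
open import Relation.Nullary.Decidable using (⌊_⌋; _×-dec_; _⊎-dec_; _→-dec_)
open import Relation.Nullary.Negation using (contradiction)
open import Relation.Binary.PropositionalEquality
  using (_≡_; _≢_; refl; sym; trans; cong; cong₂; subst; module ≡-Reasoning)

private variable
  A : Set
  R : A → A → Set
  x : A
  xs v : List A
  k : ℕ

Linked-reverse⁺ : Linked R xs → Linked (flip R) (reverse xs)
Linked-reverse⁺ {xs = []} [] = []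
Linked-reverse⁺ {xs = _ ∷ _} l = go [-] l
  where
  go : ∀ {x xs ys} → Linked (flip R) (x ∷ ys) → Linked R (x ∷ xs) →
       Linked (flip R) (reverseAcc ys (x ∷ xs))
  go l' [-] = l'
  go l' (r ∷ l) = go (r ∷ l') l

Linked-++⁻ʳ : ∀ xs → Linked R (xs ++ v) → Linked R v
Linked-++⁻ʳ [] l = l
Linked-++⁻ʳ (x ∷ xs) l = Linked-++⁻ʳ xs (Linked.tail l)

Linked-++⁻ˡ : ∀ xs → Linked R (xs ++ v) → Linked R xs
Linked-++⁻ˡ [] _ = []
Linked-++⁻ˡ (x ∷ []) _ = [-]
Linked-++⁻ˡ (x ∷ y ∷ xs) (r ∷ l) = r ∷ Linked-++⁻ˡ (y ∷ xs) l

Linked-++⁺ : Linked R xs → Linked R v → All (λ x → All (R x) v) xs → Linked R (xs ++ v)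
Linked-++⁺ [] l _ = l
Linked-++⁺ [-] [] _ = [-]
Linked-++⁺ [-] [-] ((r ∷ []) ∷ []) = r ∷ [-]
Linked-++⁺ [-] (s ∷ l) ((r ∷ _) ∷ []) = r ∷ s ∷ l
Linked-++⁺ (r ∷ l) l' (_ ∷ rs) = r ∷ Linked-++⁺ l l' rs

Linked-∷⇒All : Transitive R → Linked R (x ∷ xs) → All (R x) xs
Linked-∷⇒All <-trans [-] = []
Linked-∷⇒All <-trans (r ∷ l) = Linked⇒All <-trans r l

replicate-∷⁺ : ∀ n → R x x → Linked R (x ∷ v) → Linked R (x ∷ replicate n x ++ v)
replicate-∷⁺ zero _ l = l
replicate-∷⁺ (suc n) r l = r ∷ replicate-∷⁺ n r l

reverse-replicate : ∀ n (x : A) → reverse (replicate n x) ≡ replicate n x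
reverse-replicate zero x = refl
reverse-replicate (suc n) x = begin
  reverse (x ∷ replicate n x)   ≡⟨ unfold-reverse x (replicate n x) ⟩
  reverse (replicate n x) ++ [ x ] ≡⟨ cong (_++ [ x ]) (reverse-replicate n x) ⟩
  replicate n x ++ [ x ]        ≡⟨ snoc n ⟩
  x ∷ replicate n x ∎
  where
  open ≡-Reasoning
  snoc : ∀ n → replicate n x ++ [ x ] ≡ x ∷ replicate n x
  snoc zero = refl
  snoc (suc n) = cong (x ∷_) (snoc n)

Positive : Vec ℕ k → Set
Positive as = All (0 ℕ.<_) (Vec.toList as)

runs : Vec ℕ k → Vec A k → List A
runs as is = concat (Vec.toList (Vec.zipWith replicate as is))

∷-runs⁺ : ∀ {as : Vec ℕ k} {is : Vec A k} → Reflexive R → Positive as →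
          Linked R (x ∷ Vec.toList is ++ v) → Linked R (x ∷ runs as is ++ v)
∷-runs⁺ {as = []} {[]} _ _ l = l
∷-runs⁺ {v = v} {as = suc a ∷ as} {i ∷ is} r (_ ∷ pos) (s ∷ l)
  rewrite ++-assoc (replicate a i) (runs as is) v = s ∷ replicate-∷⁺ a r (∷-runs⁺ r pos l)

runs⁺ : ∀ {as : Vec ℕ k} {is : Vec A k} → Reflexive R → Positive as →
        Linked R (x ∷ Vec.toList is) → Linked R (x ∷ runs as is)
runs⁺ {R = R} {x = x} {as = as} {is} r pos l =
  subst (λ u → Linked R (x ∷ u)) (++-identityʳ (runs as is))
    (∷-runs⁺ r pos (subst (λ u → Linked R (x ∷ u)) (sym (++-identityʳ (Vec.toList is))) l))

block-cons : ∀ a (as : Vec ℕ k) i is → block (a ∷ as) (i ∷ is) ≡ block as is ++ replicate a i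
block-cons a as i is = begin
  reverse (replicate a i ++ runs as is)         ≡⟨ reverse-++ (replicate a i) (runs as is) ⟩
  block as is ++ reverse (replicate a i)        ≡⟨ cong (block as is ++_) (reverse-replicate a i) ⟩
  block as is ++ replicate a i ∎
  where open ≡-Reasoning

block-All : ∀ {P : ℤ → Set} (as : Vec ℕ k) is → All P (Vec.toList is) → All P (block as is)
block-All [] [] _ = []
block-All (a ∷ as) (i ∷ is) (p ∷ ps) rewrite block-cons a as i is =
  AllP.++⁺ (block-All as is ps) (AllP.replicate⁺ a p)

block-nonincreasing : ∀ {as : Vec ℕ k} {is} → Positive as → StrictlyIncreasing is →
                      Nonincreasing (block as is)
block-nonincreasing {as = []} {[]} _ _ = []
block-nonincreasing {as = _ ∷ _} {i ∷ is} pos si =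
  Linked-reverse⁺ (Linked.tail (runs⁺ ℤP.≤-refl pos (ℤP.≤-refl ∷ Linked.map ℤP.<⇒≤ si)))

block-below : ∀ {b} {m : List ℤ} (as : Vec ℕ k) is → All (b <_) m → All (_≤ b) (Vec.toList is) →
              All (λ y → All (_< y) (block as is)) m
block-below as is mb ib =
  All.map (λ b<y → All.map (λ z≤b → ℤP.≤-<-trans z≤b b<y) (block-All as is ib)) mb

m++block-nonincreasing : ∀ {b} {m : List ℤ} {as : Vec ℕ k} {is} →
  Nonincreasing m → All (b <_) m → Positive as → StrictlyIncreasing is → All (_≤ b) (Vec.toList is) →
  Nonincreasing (m ++ block as is)
m++block-nonincreasing {as = as} {is} nm mb pos si ib =
  Linked-++⁺ nm (block-nonincreasing pos si) (All.map (All.map ℤP.<⇒≤) (block-below as is mb ib))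

-- Flat words and the relaxed slide condition

isYes-< : ∀ {i j} → i < j → ⌊ i <? j ⌋ ≡ true
isYes-< {i} {j} i<j with i <? j
... | yes _ = refl
... | no i≮j = contradiction i<j i≮j

isYes-<-irrefl : ∀ i → ⌊ i <? i ⌋ ≡ false
isYes-<-irrefl i with i <? i
... | yes i<i = contradiction i<i (ℤP.<-irrefl refl)
... | no _ = refl

≤ᵇ-true : ∀ {i j} → i ≤ j → (i ≤ᵇ j) ≡ true
≤ᵇ-true i≤j = Equivalence.to T-≡ (ℤP.≤⇒≤ᵇ i≤j)

≤ᵇ-false : ∀ {i j} → ¬ i ≤ j → (i ≤ᵇ j) ≡ false
≤ᵇ-false {i} {j} i≰j with i ≤ᵇ j in eq
... | true = contradiction (ℤP.≤ᵇ⇒≤ (subst T (sym eq) _)) i≰j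
... | false = refl

FlatStep : ℤ → ℤ → ℤ → Set
FlatStep b x y = y ≤ b → y ≡ b ⊎ x ≤ ℤ.suc y

-- The entries of D that are at most b start at b and go down in steps of at most one.
Flat : ℤ → List ℤ → Set
Flat b D = Linked (FlatStep b) (ℤ.suc b ∷ D)

atMost : ℤ → ℤ → ℤ → Bool
atMost b i d = (i ≤ᵇ b) ∨ (i ≤ᵇ d)

relaxedSlideOK : ℤ → List ℤ → List ℤ → Bool
relaxedSlideOK b [] [] = true
relaxedSlideOK b (i ∷ []) (d ∷ []) = atMost b i d
relaxedSlideOK b (i ∷ i' ∷ is) (d ∷ d' ∷ ds) =
  atMost b i d ∧ (not ⌊ d' <? d ⌋ ∨ ⌊ i' <? i ⌋) ∧ relaxedSlideOK b (i' ∷ is) (d' ∷ ds)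
relaxedSlideOK _ _ _ = false

atMost≡≤ᵇ : ∀ {b i d} → (i ≤ b → d ≤ b → i ≤ d) → atMost b i d ≡ (i ≤ᵇ d)
atMost≡≤ᵇ {b} {i} {d} h with i ≤? d
... | yes i≤d rewrite ≤ᵇ-true i≤d = ∨-zeroʳ (i ≤ᵇ b)
... | no i≰d with i ≤? b
...   | yes i≤b = contradiction (h i≤b (ℤP.≤-trans (ℤP.<⇒≤ (ℤP.≰⇒> i≰d)) i≤b)) i≰d
...   | no i≰b rewrite ≤ᵇ-false i≰d | ≤ᵇ-false i≰b = refl

<suc⇒≤ : ∀ {i j} → i < ℤ.suc j → i ≤ j
<suc⇒≤ {i} {j} i<j+1 = subst (i ≤_) (ℤP.pred-suc j) (ℤP.i<j⇒i≤pred[j] i<j+1)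

≤⇒<suc : ∀ {i j} → i ≤ j → i < ℤ.suc j
≤⇒<suc i≤j = ℤP.suc[i]≤j⇒i<j (ℤP.suc-mono i≤j)

FlatStep-dominated : ∀ {b d d' i} → FlatStep b d d' → i < d → i ≤ b → d' ≤ b → i ≤ d'
FlatStep-dominated s i<d i≤b d'≤b with s d'≤b
... | inj₁ refl = i≤b
... | inj₂ d≤d'+1 = <suc⇒≤ (ℤP.<-≤-trans i<d d≤d'+1)

-- Along a flat D, the waived bounds i ≤ d with i ≤ b are forced by the other slide conditions.
relaxedSlideOK≡slideOK : ∀ {b w D} → Flat b D → Nonincreasing w → relaxedSlideOK b w D ≡ slideOK w D
relaxedSlideOK≡slideOK {w = []} {[]} _ _ = refl
relaxedSlideOK≡slideOK {w = []} {_ ∷ _} _ _ = refl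
relaxedSlideOK≡slideOK {w = _ ∷ []} {[]} _ _ = refl
relaxedSlideOK≡slideOK {w = _ ∷ _ ∷ _} {[]} _ _ = refl
relaxedSlideOK≡slideOK {b} {_ ∷ _} {_ ∷ _} (s ∷ fl) nw =
  go (λ i≤b → FlatStep-dominated s (≤⇒<suc i≤b) i≤b) nw fl
  where
  go : ∀ {i is d ds} → (i ≤ b → d ≤ b → i ≤ d) →
       Nonincreasing (i ∷ is) → Linked (FlatStep b) (d ∷ ds) →
       relaxedSlideOK b (i ∷ is) (d ∷ ds) ≡ slideOK (i ∷ is) (d ∷ ds)
  go {is = []} {ds = []} h _ _ = atMost≡≤ᵇ h
  go {is = []} {ds = _ ∷ _} _ _ _ = refl
  go {is = _ ∷ _} {ds = []} _ _ _ = refl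
  go {i} {i' ∷ _} {d} {d' ∷ _} h (i'≤i ∷ nw) (s ∷ fl) rewrite atMost≡≤ᵇ h with i ≤? d
  ... | no i≰d rewrite ≤ᵇ-false i≰d = refl
  ... | yes i≤d rewrite ≤ᵇ-true i≤d with d' <? d
  ...   | no d'≮d = go (λ _ _ → ℤP.≤-trans i'≤i (ℤP.≤-trans i≤d (ℤP.≮⇒≥ d'≮d))) nw fl
  ...   | yes _ with i' <? i
  ...     | no _ = refl
  ...     | yes i'<i = go (FlatStep-dominated s (ℤP.<-≤-trans i'<i i≤d)) nw fl

EqualOrBelow : ℤ → ℤ → ℤ → Set
EqualOrBelow b x y = x ≡ y ⊎ (x ≤ b × y ≤ b)

data Similar (b : ℤ) : List ℤ → List ℤ → Set where
  [] : Similar b [] []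
  [-] : ∀ {x y} → EqualOrBelow b x y → Similar b [ x ] [ y ]
  _∷⟨_⟩_ : ∀ {x x' y y' xs ys} → EqualOrBelow b x y → ⌊ x' <? x ⌋ ≡ ⌊ y' <? y ⌋ →
           Similar b (x' ∷ xs) (y' ∷ ys) → Similar b (x ∷ x' ∷ xs) (y ∷ y' ∷ ys)

atMost-resp : ∀ {b x y} d → EqualOrBelow b x y → atMost b x d ≡ atMost b y d
atMost-resp d (inj₁ refl) = refl
atMost-resp d (inj₂ (x≤b , y≤b)) rewrite ≤ᵇ-true x≤b | ≤ᵇ-true y≤b = refl

relaxedSlideOK-resp : ∀ {b w w'} → Similar b w w' → ∀ D → relaxedSlideOK b w D ≡ relaxedSlideOK b w' D
relaxedSlideOK-resp [] D = refl
relaxedSlideOK-resp ([-] e) [] = refl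
relaxedSlideOK-resp ([-] e) (d ∷ []) = atMost-resp d e
relaxedSlideOK-resp ([-] e) (_ ∷ _ ∷ _) = refl
relaxedSlideOK-resp (e ∷⟨ _ ⟩ _) [] = refl
relaxedSlideOK-resp (e ∷⟨ _ ⟩ _) (_ ∷ []) = refl
relaxedSlideOK-resp (e ∷⟨ desc ⟩ s) (d ∷ d' ∷ ds)
  rewrite atMost-resp d e | desc | relaxedSlideOK-resp s (d' ∷ ds) = refl

Similar-refl : ∀ {b} w → Similar b w w
Similar-refl [] = []
Similar-refl (x ∷ []) = [-] (inj₁ refl)
Similar-refl (x ∷ x' ∷ w) = inj₁ refl ∷⟨ refl ⟩ Similar-refl (x' ∷ w)

Similar-replicate : ∀ {b x y} n → EqualOrBelow b x y → Similar b (replicate n x) (replicate n y)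
Similar-replicate zero e = []
Similar-replicate (suc zero) e = [-] e
Similar-replicate {x = x} {y} (suc (suc n)) e =
  e ∷⟨ trans (isYes-<-irrefl x) (sym (isYes-<-irrefl y)) ⟩ Similar-replicate (suc n) e

Similar-++ : ∀ {b u u' v v'} → Similar b u u' → Similar b v v' →
  All (λ x → All (_< x) v) u → All (λ x → All (_< x) v') u' → Similar b (u ++ v) (u' ++ v')
Similar-++ [] t _ _ = t
Similar-++ ([-] e) [] _ _ = [-] e
Similar-++ ([-] e) t@([-] _) ((p ∷ []) ∷ []) ((p' ∷ []) ∷ []) =
  e ∷⟨ trans (isYes-< p) (sym (isYes-< p')) ⟩ t
Similar-++ ([-] e) t@(_ ∷⟨ _ ⟩ _) ((p ∷ _) ∷ []) ((p' ∷ _) ∷ []) =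
  e ∷⟨ trans (isYes-< p) (sym (isYes-< p')) ⟩ t
Similar-++ (e ∷⟨ desc ⟩ s) t (_ ∷ sep) (_ ∷ sep') = e ∷⟨ desc ⟩ Similar-++ s t sep sep'

Similar-length : ∀ {b u v} → Similar b u v → length u ≡ length v
Similar-length [] = refl
Similar-length ([-] _) = refl
Similar-length (_ ∷⟨ _ ⟩ s) = cong suc (Similar-length s)

Similar-block : ∀ {b} (as : Vec ℕ k) (is js : Vec ℤ k) →
  StrictlyIncreasing is → All (_≤ b) (Vec.toList is) →
  StrictlyIncreasing js → All (_≤ b) (Vec.toList js) → Similar b (block as is) (block as js)
Similar-block [] [] [] _ _ _ _ = []
Similar-block (a ∷ as) (i ∷ is) (j ∷ js) si (i≤b ∷ ib) sj (j≤b ∷ jb)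
  rewrite block-cons a as i is | block-cons a as j js =
  Similar-++ (Similar-block as is js (Linked.tail si) ib (Linked.tail sj) jb)
    (Similar-replicate a (inj₂ (i≤b , j≤b))) (above si) (above sj)
  where
  above : ∀ {i is} → StrictlyIncreasing (i ∷ is) →
          All (λ x → All (_< x) (replicate a i)) (block as is)
  above si = block-All as _ (All.map (AllP.replicate⁺ a) (Linked-∷⇒All ℤP.<-trans si))

QsymBelow : ℤ → Series → Set
QsymBelow b f = ∀ k (a : Vec ℕ k) → Positive a
  → (m : List ℤ) → Nonincreasing m → All (b <_) m
  → (is js : Vec ℤ k)
  → StrictlyIncreasing is → All (_≤ b) (Vec.toList is)
  → StrictlyIncreasing js → All (_≤ b) (Vec.toList js)
  → f (m ++ block a is) ≡ f (m ++ block a js)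

slideOK-resp : ∀ {b w w' D} → Flat b D → Nonincreasing w → Nonincreasing w' → Similar b w w' →
               slideOK w D ≡ slideOK w' D
slideOK-resp {b} {w} {w'} {D} fl nw nw' s = begin
  slideOK w D            ≡⟨ sym (relaxedSlideOK≡slideOK fl nw) ⟩
  relaxedSlideOK b w D   ≡⟨ relaxedSlideOK-resp s D ⟩
  relaxedSlideOK b w' D  ≡⟨ relaxedSlideOK≡slideOK fl nw' ⟩
  slideOK w' D ∎
  where open ≡-Reasoning

backSlide-qsymBelow : ∀ {b D} → Flat b D → QsymBelow b (backSlide D)
backSlide-qsymBelow fl k a pos m nm mb is js si ib sj jb =
  cong (λ t → if t then 1ℚ else 0ℚ)
    (slideOK-resp fl (m++block-nonincreasing nm mb pos si ib) (m++block-nonincreasing nm mb pos sj jb)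
      (Similar-++ (Similar-refl m) (Similar-block a is js si ib sj jb)
        (block-below a is mb ib) (block-below a js mb jb)))

Flat-++ : ∀ {b m t} → All (b <_) m → (∀ q → Linked (FlatStep b) (q ∷ t)) →
          ∀ p → Linked (FlatStep b) (p ∷ m ++ t)
Flat-++ [] flat-t p = flat-t p
Flat-++ (b<y ∷ bm) flat-t p = (λ y≤b → contradiction y≤b (ℤP.<⇒≱ b<y)) ∷ Flat-++ bm flat-t _

above⇒Flat : ∀ {b D} → All (b <_) D → Flat b D
above⇒Flat {b} {D} bD =
  subst (λ u → Linked (FlatStep b) (ℤ.suc b ∷ u)) (++-identityʳ D) (Flat-++ bD (λ _ → [-]) _)

-- Slides are unitriangular

slideOK⇒Pointwise : ∀ w D → T (slideOK w D) → Pointwise _≤_ w D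
slideOK⇒Pointwise [] [] _ = []
slideOK⇒Pointwise (i ∷ []) (d ∷ []) t = ℤP.≤ᵇ⇒≤ t ∷ []
slideOK⇒Pointwise (i ∷ i' ∷ is) (d ∷ d' ∷ ds) t =
  let (i≤d , rest) = Equivalence.to T-∧ t
  in ℤP.≤ᵇ⇒≤ i≤d ∷ slideOK⇒Pointwise (i' ∷ is) (d' ∷ ds) (proj₂ (Equivalence.to T-∧ rest))
slideOK⇒Pointwise [] (_ ∷ _) ()
slideOK⇒Pointwise (_ ∷ []) [] ()
slideOK⇒Pointwise (_ ∷ []) (_ ∷ _ ∷ _) ()
slideOK⇒Pointwise (_ ∷ _ ∷ _) [] ()
slideOK⇒Pointwise (_ ∷ _ ∷ _) (_ ∷ []) ()

slideOK-refl : ∀ D → T (slideOK D D)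
slideOK-refl [] = _
slideOK-refl (d ∷ []) = ℤP.≤⇒≤ᵇ (ℤP.≤-refl {d})
slideOK-refl (d ∷ d' ∷ ds) = Equivalence.from (T-∧ {d ≤ᵇ d})
  ( ℤP.≤⇒≤ᵇ (ℤP.≤-refl {d})
  , Equivalence.from T-∧ (subst T (sym (∨-inverseˡ ⌊ d' <? d ⌋)) _ , slideOK-refl (d' ∷ ds)))

backSlide-vanishes : ∀ {D w} → ¬ Pointwise _≤_ w D → backSlide D w ≡ 0ℚ
backSlide-vanishes {D} {w} ¬w≤D with slideOK w D in eq
... | true = contradiction (slideOK⇒Pointwise w D (subst T (sym eq) _)) ¬w≤D
... | false = refl

backSlide-self : ∀ D → backSlide D D ≡ 1ℚ
backSlide-self D with slideOK D D | slideOK-refl D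
... | true | _ = refl

Pointwise≤-bounded : ∀ {w D N} → Pointwise _≤_ w D → All (_≤ N) D → All (_≤ N) w
Pointwise≤-bounded [] [] = []
Pointwise≤-bounded (x≤y ∷ w≤D) (y≤N ∷ D≤N) =
  ℤP.≤-trans x≤y y≤N ∷ Pointwise≤-bounded w≤D D≤N

sumℤ : List ℤ → ℤ
sumℤ = foldr ℤ._+_ 0ℤ

Pointwise≤-sum : ∀ {w D} → Pointwise _≤_ w D → sumℤ w ≤ sumℤ D
Pointwise≤-sum [] = ℤP.≤-refl
Pointwise≤-sum (x≤y ∷ w≤D) = ℤP.+-mono-≤ x≤y (Pointwise≤-sum w≤D)

Pointwise≤-sum-< : ∀ {w D} → Pointwise _≤_ w D → w ≢ D → sumℤ w < sumℤ D
Pointwise≤-sum-< [] w≢D = contradiction refl w≢D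
Pointwise≤-sum-< {x ∷ w} {y ∷ D} (x≤y ∷ w≤D) x∷w≢y∷D with x ℤ.≟ y
... | no x≢y = ℤP.+-mono-<-≤ (ℤP.≤∧≢⇒< x≤y x≢y) (Pointwise≤-sum w≤D)
... | yes refl = ℤP.+-monoʳ-< x (Pointwise≤-sum-< w≤D (λ w≡D → x∷w≢y∷D (cong (x ∷_) w≡D)))

backSlide-triangular : ∀ {D w} → D ≢ w → sumℤ D ≤ sumℤ w → backSlide D w ≡ 0ℚ
backSlide-triangular D≢w ΣD≤Σw =
  backSlide-vanishes (λ w≤D →
    ℤP.<⇒≱ (Pointwise≤-sum-< w≤D (λ w≡D → D≢w (sym w≡D))) ΣD≤Σw)

DegreeBounded : ℕ → Series → Set
DegreeBounded d f = ∀ w → Nonincreasing w → d ℕ.< length w → f w ≡ 0ℚ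

SupportedBelow : ℤ → Series → Set
SupportedBelow N f = ∀ w → Nonincreasing w → Any (N <_) w → f w ≡ 0ℚ

backSlide-degreeBounded : ∀ {d D} → length D ℕ.≤ d → DegreeBounded d (backSlide D)
backSlide-degreeBounded {D = D} D≤d w _ d<w =
  backSlide-vanishes {D} {w} (λ w≤D →
    ℕP.<⇒≱ (ℕP.≤-<-trans D≤d d<w) (ℕP.≤-reflexive (Pointwise-length w≤D)))

backSlide-supportedBelow : ∀ {N D} → All (_≤ N) D → SupportedBelow N (backSlide D)
backSlide-supportedBelow {D = D} D≤N w _ high = backSlide-vanishes {D} {w} (λ w≤D →
  AllP.All¬⇒¬Any (All.map (λ y≤N N<y → ℤP.<⇒≱ N<y y≤N) (Pointwise≤-bounded w≤D D≤N)) high)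

backSlide-inQR : ∀ D → InQR (backSlide D)
backSlide-inQR D =
    ( (length D , backSlide-degreeBounded ℕP.≤-refl)
    , (max 0ℤ D , backSlide-supportedBelow (xs≤max 0ℤ D)))
  , (ℤ.pred (min 0ℤ D) , backSlide-qsymBelow (above⇒Flat below))
  where
  below : All (ℤ.pred (min 0ℤ D) <_) D
  below = All.map (ℤP.<-≤-trans (ℤP.i≤pred[j]⇒i<j ℤP.≤-refl)) (min≤xs 0ℤ D)

linComb-vanishes : ∀ L {w} → All (λ p → backSlide (proj₂ p) w ≡ 0ℚ) L → linComb L w ≡ 0ℚ
linComb-vanishes [] [] = refl
linComb-vanishes ((q , D) ∷ L) {w} (F≡0 ∷ Fs≡0) = begin
  q ℚ.* backSlide D w ℚ.+ linComb L w
    ≡⟨ cong₂ (λ s t → q ℚ.* s ℚ.+ t) F≡0 (linComb-vanishes L Fs≡0) ⟩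
  q ℚ.* 0ℚ ℚ.+ 0ℚ
    ≡⟨ cong (ℚ._+ 0ℚ) (ℚP.*-zeroʳ q) ⟩
  0ℚ ∎
  where open ≡-Reasoning

linComb-cong : ∀ L {u v} → All (λ p → backSlide (proj₂ p) u ≡ backSlide (proj₂ p) v) L →
               linComb L u ≡ linComb L v
linComb-cong [] [] = refl
linComb-cong ((q , D) ∷ L) (F≡ ∷ Fs≡) = cong₂ (λ s t → q ℚ.* s ℚ.+ t) F≡ (linComb-cong L Fs≡)

linComb-qsymBelow : ∀ {b} L → All (λ p → Flat b (proj₂ p)) L → QsymBelow b (linComb L)
linComb-qsymBelow L flat k a pos m nm mb is js si ib sj jb =
  linComb-cong L (All.map (λ fl → backSlide-qsymBelow fl k a pos m nm mb is js si ib sj jb) flat)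

linComb-without-zeros : ∀ L w → linComb (filter (λ p → ¬? (proj₁ p ℚ.≟ 0ℚ)) L) w ≡ linComb L w
linComb-without-zeros [] w = refl
linComb-without-zeros ((q , D) ∷ L) w with q ℚ.≟ 0ℚ
... | no _ = cong (q ℚ.* backSlide D w ℚ.+_) (linComb-without-zeros L w)
... | yes refl = begin
  linComb (filter _ L) w            ≡⟨ linComb-without-zeros L w ⟩
  linComb L w                       ≡⟨ sym (ℚP.+-identityˡ _) ⟩
  0ℚ ℚ.+ linComb L w                ≡⟨ cong (ℚ._+ linComb L w) (sym (ℚP.*-zeroˡ (backSlide D w))) ⟩
  0ℚ ℚ.* backSlide D w ℚ.+ linComb L w ∎
  where open ≡-Reasoning

linComb-at-maximal : ∀ {L e} → Unique (map proj₂ L) → e ∈ L →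
  All (λ p → sumℤ (proj₂ p) ≤ sumℤ (proj₂ e)) L → linComb L (proj₂ e) ≡ proj₁ e
linComb-at-maximal {(q , D) ∷ L} (D∉L ∷ _) (here refl) (_ ∷ max) = begin
  q ℚ.* backSlide D D ℚ.+ linComb L D
    ≡⟨ cong₂ (λ s t → q ℚ.* s ℚ.+ t) (backSlide-self D) rest≡0 ⟩
  q ℚ.* 1ℚ ℚ.+ 0ℚ
    ≡⟨ trans (ℚP.+-identityʳ _) (ℚP.*-identityʳ q) ⟩
  q ∎
  where
  open ≡-Reasoning
  rest≡0 : linComb L D ≡ 0ℚ
  rest≡0 = linComb-vanishes L
    (All.zipWith (λ (D≢D' , ΣD'≤ΣD) → backSlide-triangular (λ D'≡D → D≢D' (sym D'≡D)) ΣD'≤ΣD)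
      (AllP.map⁻ D∉L , max))
linComb-at-maximal {(q , D) ∷ L} {e} (D∉L ∷ uniq) (there e∈L) (ΣD≤Σe ∷ max) = begin
  q ℚ.* backSlide D (proj₂ e) ℚ.+ linComb L (proj₂ e)
    ≡⟨ cong₂ (λ s t → q ℚ.* s ℚ.+ t) F≡0 (linComb-at-maximal uniq e∈L max) ⟩
  q ℚ.* 0ℚ ℚ.+ proj₁ e
    ≡⟨ cong (ℚ._+ proj₁ e) (ℚP.*-zeroʳ q) ⟩
  0ℚ ℚ.+ proj₁ e
    ≡⟨ ℚP.+-identityˡ _ ⟩
  proj₁ e ∎
  where
  open ≡-Reasoning
  F≡0 : backSlide D (proj₂ e) ≡ 0ℚ
  F≡0 = backSlide-triangular (All.lookup D∉L (∈-map⁺ proj₂ e∈L)) ΣD≤Σe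

slides-independent : ∀ L → All (λ p → Nonincreasing (proj₂ p)) L → Unique (map proj₂ L) →
                     linComb L ≈ₛ zeroS → All (λ p → proj₁ p ≡ 0ℚ) L
slides-independent L ni uniq L≈0 = All.tabulate coefficient≡0
  where
  nonzero? = λ (p : ℚ × List ℤ) → ¬? (proj₁ p ℚ.≟ 0ℚ)
  L' = filter nonzero? L
  uniq' : Unique (map proj₂ L')
  uniq' = APP.map⁺ (APP.filter⁺ nonzero? (APP.map⁻ uniq))
  -- a nonzero coefficient would survive in L', and the maximal term of L' would then have coefficient 0
  coefficient≡0 : ∀ {p} → p ∈ L → proj₁ p ≡ 0ℚ
  coefficient≡0 {p} p∈L with proj₁ p ℚ.≟ 0ℚ
  ... | yes q≡0 = q≡0
  ... | no q≢0 = contradiction qₑ≡0 (proj₂ (∈-filter⁻ nonzero? {xs = L} e∈L'))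
    where
    p∈L' : p ∈ L'
    p∈L' = ∈-filter⁺ nonzero? p∈L q≢0
    e = argmax (λ p → sumℤ (proj₂ p)) p L'
    e∈L' : e ∈ L'
    e∈L' with argmax-sel (λ p → sumℤ (proj₂ p)) p L'
    ... | inj₁ e≡p = subst (_∈ L') (sym e≡p) p∈L'
    ... | inj₂ e∈ = e∈
    e∈L : e ∈ L
    e∈L = proj₁ (∈-filter⁻ nonzero? {xs = L} e∈L')
    qₑ≡0 : proj₁ e ≡ 0ℚ
    qₑ≡0 = begin
      proj₁ e                ≡⟨ sym (linComb-at-maximal uniq' e∈L' (f[xs]≤f[argmax] p L')) ⟩
      linComb L' (proj₂ e)   ≡⟨ linComb-without-zeros L (proj₂ e) ⟩
      linComb L (proj₂ e)    ≡⟨ L≈0 (proj₂ e) (All.lookup ni e∈L) ⟩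
      0ℚ ∎
      where open ≡-Reasoning

x≡y+[x-y] : ∀ x y → x ≡ y ℚ.+ (x ℚ.- y)
x≡y+[x-y] = solve 2 (λ x y → x := y :+ (x :- y)) refl
  where open +-*-Solver

-- Gaussian elimination: peel off a word e of maximal total, with coefficient f e, and recurse on
-- f - (f e)·F_e over the remaining words.
triangular-solve : ∀ (f : Series) (P : List (List ℤ)) →
  ∃ λ L → All (λ p → proj₂ p ∈ P) L × (∀ {w} → w ∈ P → f w ≡ linComb L w)
triangular-solve f P = go f P (<-wellFounded (length P))
  where
  go : ∀ (f : Series) P → Acc ℕ._<_ (length P) →
       ∃ λ L → All (λ p → proj₂ p ∈ P) L × (∀ {w} → w ∈ P → f w ≡ linComb L w)
  go f [] _ = [] , [] , λ ()
  go f P@(w₀ ∷ P₀) (acc rec) =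
    (f e , e) ∷ L' , e∈P ∷ All.map (proj₁ ∘ ∈-filter⁻ other? {xs = P}) L'⊆P' , solves
    where
    e = argmax sumℤ w₀ P₀
    e∈P : e ∈ P
    e∈P with argmax-sel sumℤ w₀ P₀
    ... | inj₁ e≡w₀ = here e≡w₀
    ... | inj₂ e∈P₀ = there e∈P₀
    maximal : All (λ w → sumℤ w ≤ sumℤ e) P
    maximal = f[⊥]≤f[argmax] {f = sumℤ} w₀ P₀ ∷ f[xs]≤f[argmax] w₀ P₀
    other? = λ w → ¬? (≡-dec ℤ._≟_ w e)
    P' = filter other? P
    shorter : length P' ℕ.< length P
    shorter = filter-notAll other? P (Any.map (λ e≡w w≢e → w≢e (sym e≡w)) e∈P)
    g : Series
    g w = f w ℚ.- f e ℚ.* backSlide e w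
    solution = go g P' (rec shorter)
    L' = proj₁ solution
    L'⊆P' = proj₁ (proj₂ solution)
    L'≡0 : linComb L' e ≡ 0ℚ
    L'≡0 = linComb-vanishes L' (All.map (λ D∈P' →
      let (D∈P , D≢e) = ∈-filter⁻ other? {xs = P} D∈P'
      in backSlide-triangular D≢e (All.lookup maximal D∈P)) L'⊆P')
    solves : ∀ {w} → w ∈ P → f w ≡ f e ℚ.* backSlide e w ℚ.+ linComb L' w
    solves {w} w∈P with ≡-dec ℤ._≟_ w e
    ... | no w≢e = begin
      f w                                    ≡⟨ x≡y+[x-y] (f w) (f e ℚ.* backSlide e w) ⟩
      f e ℚ.* backSlide e w ℚ.+ g w          ≡⟨ cong (f e ℚ.* backSlide e w ℚ.+_) g≡L' ⟩
      f e ℚ.* backSlide e w ℚ.+ linComb L' w ∎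
      where
      open ≡-Reasoning
      g≡L' = proj₂ (proj₂ solution) (∈-filter⁺ other? w∈P w≢e)
    ... | yes refl = begin
      f e                                    ≡⟨ sym (ℚP.*-identityʳ (f e)) ⟩
      f e ℚ.* 1ℚ                             ≡⟨ sym (ℚP.+-identityʳ _) ⟩
      f e ℚ.* 1ℚ ℚ.+ 0ℚ
        ≡⟨ cong₂ (λ s t → f e ℚ.* s ℚ.+ t) (sym (backSlide-self e)) (sym L'≡0) ⟩
      f e ℚ.* backSlide e e ℚ.+ linComb L' e ∎
      where open ≡-Reasoning

-- Canonical representatives of monomials

split-above : ∀ b w → Nonincreasing w →
              ∃ λ m → ∃ λ t → w ≡ m ++ t × All (b <_) m × All (_≤ b) t
split-above b [] _ = [] , [] , refl , [] , []
split-above b (x ∷ w) nw with b <? x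
... | yes b<x = let (m , t , w≡ , mb , tb) = split-above b w (Linked.tail nw)
                in x ∷ m , t , cong (x ∷_) w≡ , b<x ∷ mb , tb
... | no b≮x = [] , x ∷ w , refl , [] , x≤b ∷ All.map (λ y≤x → ℤP.≤-trans y≤x x≤b) w≤x
  where
  x≤b = ℤP.≮⇒≥ b≮x
  w≤x = Linked-∷⇒All (λ p q → ℤP.≤-trans q p) nw

runs-decomposition : ∀ {r} → Linked _≤_ r →
  ∃ λ k → Σ (Vec ℕ k) λ as → Σ (Vec ℤ k) λ is →
    r ≡ runs as is × Positive as × StrictlyIncreasing is
runs-decomposition [] = 0 , [] , [] , refl , [] , []
runs-decomposition {x ∷ []} [-] = 1 , 1 ∷ [] , x ∷ [] , refl , ℕ.s≤s ℕ.z≤n ∷ [] , [-]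
runs-decomposition {x ∷ y ∷ r} (x≤y ∷ l) with runs-decomposition l
... | 0 , [] , [] , () , _ , _
... | suc k , zero ∷ as , _ , _ , () ∷ _ , _
... | suc k , suc a ∷ as , .y ∷ is , refl , _ ∷ pos , si with x ℤ.≟ y
...   | yes refl = suc k , suc (suc a) ∷ as , x ∷ is , refl , ℕ.s≤s ℕ.z≤n ∷ pos , si
...   | no x≢y = suc (suc k) , 1 ∷ suc a ∷ as , x ∷ y ∷ is , refl ,
                 ℕ.s≤s ℕ.z≤n ∷ ℕ.s≤s ℕ.z≤n ∷ pos , ℤP.≤∧≢⇒< x≤y x≢y ∷ si

block-decomposition : ∀ {t} → Nonincreasing t →
  ∃ λ k → Σ (Vec ℕ k) λ as → Σ (Vec ℤ k) λ is →
    t ≡ block as is × Positive as × StrictlyIncreasing is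
block-decomposition {t} nt with runs-decomposition (Linked-reverse⁺ nt)
... | k , as , is , r≡ , pos , si =
  k , as , is , trans (sym (reverse-involutive t)) (cong reverse r≡) , pos , si

block-All⁻ : ∀ {P : ℤ → Set} (as : Vec ℕ k) is → Positive as →
             All P (block as is) → All P (Vec.toList is)
block-All⁻ [] [] _ _ = []
block-All⁻ (zero ∷ as) (i ∷ is) (() ∷ _) _
block-All⁻ (suc a ∷ as) (i ∷ is) (_ ∷ pos) ps rewrite block-cons (suc a) as i is =
  All.head (AllP.++⁻ʳ (block as is) ps) ∷ block-All⁻ as is pos (AllP.++⁻ˡ (block as is) ps)

length≥-block : ∀ (as : Vec ℕ k) is → Positive as → k ℕ.≤ length (block as is)
length≥-block [] [] _ = ℕ.z≤n
length≥-block (zero ∷ as) (i ∷ is) (() ∷ _)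
length≥-block (suc a ∷ as) (i ∷ is) (_ ∷ pos)
  rewrite block-cons (suc a) as i is | length-++ (block as is) {replicate (suc a) i}
        | length-replicate (suc a) {i} | ℕP.+-suc (length (block as is)) a =
  ℕ.s≤s (ℕP.m≤n⇒m≤n+o a (length≥-block as is pos))

upFrom : ℤ → (k : ℕ) → Vec ℤ k
upFrom x zero = []
upFrom x (suc k) = ℤ.suc x ∷ upFrom (ℤ.suc x) k

suc-+-shift : ∀ x k → ℤ.suc x ℤ.+ + k ≡ x ℤ.+ + suc k
suc-+-shift x k = shift x (+ k)
  where
  shift : ∀ x n → (1ℤ ℤ.+ x) ℤ.+ n ≡ x ℤ.+ (1ℤ ℤ.+ n)
  shift = solve-∀

upFrom-strict : ∀ x k → StrictlyIncreasing (upFrom x k)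
upFrom-strict x zero = []
upFrom-strict x (suc zero) = [-]
upFrom-strict x (suc (suc k)) = ≤⇒<suc ℤP.≤-refl ∷ upFrom-strict (ℤ.suc x) (suc k)

upFrom-bounds : ∀ x k → All (λ y → x < y × y ≤ x ℤ.+ + k) (Vec.toList (upFrom x k))
upFrom-bounds x zero = []
upFrom-bounds x (suc k) =
    (x<x+1 , subst (ℤ.suc x ℤ.≤_) (suc-+-shift x k) (ℤP.i≤i+j (ℤ.suc x) (+ k)))
  ∷ All.map (λ (x+1<y , y≤) → ℤP.<-trans x<x+1 x+1<y , subst (_ ≤_) (suc-+-shift x k) y≤)
      (upFrom-bounds (ℤ.suc x) k)
  where
  x<x+1 : x < ℤ.suc x
  x<x+1 = ≤⇒<suc ℤP.≤-refl

upFrom-linked : ∀ x k → (∀ {y} → R y (ℤ.suc y)) → Linked R ((x ℤ.+ + k) ∷ v) →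
                Linked R (x ∷ Vec.toList (upFrom x k) ++ v)
upFrom-linked {R = R} {v = v} x zero _ l = subst (λ y → Linked R (y ∷ v)) (ℤP.+-identityʳ x) l
upFrom-linked {R = R} {v = v} x (suc k) step l =
  step ∷ upFrom-linked (ℤ.suc x) k step (subst (λ y → Linked R (y ∷ v)) (sym (suc-+-shift x k)) l)

i-j+j≡i : ∀ i j → i ℤ.- j ℤ.+ j ≡ i
i-j+j≡i = solve-∀

Flat-canonical : ∀ {b m} (as : Vec ℕ k) → All (b <_) m → Positive as →
                 Flat b (m ++ block as (upFrom (b ℤ.- + k) k))
Flat-canonical {k} {b} {m} as mb pos = Flat-++ mb flat-block _
  where
  js = upFrom (b ℤ.- + k) k
  top : ∀ {q} → FlatStep b q (b ℤ.- + k ℤ.+ + k)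
  top _ = inj₁ (i-j+j≡i b (+ k))
  -- read upwards, the block climbs from b - k in steps of at most one and then to any q
  ascending : ∀ q → Linked (flip (FlatStep b)) (runs as js ++ [ q ])
  ascending q = Linked.tail (∷-runs⁺ (λ _ → inj₂ (ℤP.i≤suc[i] _)) pos
    (upFrom-linked (b ℤ.- + k) k (λ _ → inj₂ ℤP.≤-refl) (top ∷ [-])))
  flat-block : ∀ q → Linked (FlatStep b) (q ∷ block as js)
  flat-block q =
    subst (Linked (FlatStep b)) (reverse-++ (runs as js) [ q ]) (Linked-reverse⁺ (ascending q))

Canonical : ℤ → ℕ → ℤ → List ℤ → Set
Canonical b d N w =
  Nonincreasing w × Flat b w × length w ℕ.≤ d × All (λ y → b ℤ.- + d < y × y ≤ N) w

-- Back quasisymmetry moves the part of w at most b to b-k+1, …, b.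
canonical-form : ∀ {b d N w} → b ≤ N → Nonincreasing w → length w ℕ.≤ d → All (_≤ N) w →
  ∃ λ w* → Canonical b d N w* × (∀ f → QsymBelow b f → f w ≡ f w*)
canonical-form {b} {d} {N} {w} b≤N nw w≤d w≤N with split-above b w nw
... | m , t , refl , mb , tb with block-decomposition (Linked-++⁻ʳ m nw)
... | k , as , is , refl , pos , si =
  m ++ block as js , (m++block-nonincreasing nm mb pos sj jb , Flat-canonical as mb pos , length≤d , bounds) ,
  λ f qsym → qsym k as pos m nm mb is js si ib sj jb
  where
  js = upFrom (b ℤ.- + k) k
  nm = Linked-++⁻ˡ m nw
  ib = block-All⁻ as is pos tb
  sj = upFrom-strict _ k
  js-bounds = upFrom-bounds (b ℤ.- + k) k
  jb : All (_≤ b) (Vec.toList js)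
  jb = All.map (λ (_ , y≤) → ℤP.≤-trans y≤ (ℤP.≤-reflexive (i-j+j≡i b (+ k)))) js-bounds
  length≤d : length (m ++ block as js) ℕ.≤ d
  length≤d = subst (ℕ._≤ d)
    (trans (length-++ m) (trans (cong (length m ℕ.+_) (Similar-length (Similar-block as is js si ib sj jb)))
      (sym (length-++ m)))) w≤d
  k≤d : k ℕ.≤ d
  k≤d = ℕP.≤-trans (length≥-block as is pos)
    (ℕP.≤-trans (ℕP.m≤n+m _ (length m)) (subst (ℕ._≤ d) (length-++ m) w≤d))
  bounds : All (λ y → b ℤ.- + d < y × y ≤ N) (m ++ block as js)
  bounds = AllP.++⁺
    (All.zipWith (λ (b<y , y≤N) → ℤP.≤-<-trans b-d≤b b<y , y≤N) (mb , AllP.++⁻ˡ m w≤N))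
    (block-All as js
      (All.zipWith (λ ((lo<y , _) , y≤b) → ℤP.≤-<-trans b-d≤b-k lo<y , ℤP.≤-trans y≤b b≤N)
        (js-bounds , jb)))
    where
    b-d≤b = ℤP.i-j≤i b (+ d)
    b-d≤b-k = ℤP.+-monoʳ-≤ b (ℤP.neg-mono-≤ (ℤ.+≤+ k≤d))

agree-on-canonical : ∀ {b d N f g} → b ≤ N →
  DegreeBounded d f → DegreeBounded d g → SupportedBelow N f → SupportedBelow N g →
  QsymBelow b f → QsymBelow b g → (∀ w → Canonical b d N w → f w ≡ g w) → f ≈ₛ g
agree-on-canonical {d = d} {N} {f} {g} b≤N df dg sf sg qf qg agree w nw with d ℕ.<? length w
... | yes long = trans (df w nw long) (sym (dg w nw long))
... | no short with Any.any? (N <?_) w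
...   | yes high = trans (sf w nw high) (sym (sg w nw high))
...   | no low = begin
  f w   ≡⟨ moves f qf ⟩
  f w*  ≡⟨ agree w* can ⟩
  g w*  ≡⟨ sym (moves g qg) ⟩
  g w ∎
  where
  open ≡-Reasoning
  form = canonical-form b≤N nw (ℕP.≮⇒≥ short) (All.map ℤP.≮⇒≥ (AllP.¬Any⇒All¬ w low))
  w* = proj₁ form
  can = proj₁ (proj₂ form)
  moves = proj₂ (proj₂ form)

words : ℕ → List ℤ → List (List ℤ)
words zero R = [ [] ]
words (suc d) R = [] ∷ cartesianProductWith _∷_ R (words d R)

∈-words : ∀ {d R w} → length w ℕ.≤ d → All (_∈ R) w → w ∈ words d R
∈-words {zero} {w = []} _ _ = here refl
∈-words {suc d} {w = []} _ _ = here refl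
∈-words {suc d} {w = x ∷ w} (ℕ.s≤s w≤d) (x∈R ∷ w⊆R) =
  there (∈-cartesianProductWith⁺ _∷_ x∈R (∈-words w≤d w⊆R))

∈-upFrom : ∀ {x k y} → x < y → y ≤ x ℤ.+ + k → y ∈ Vec.toList (upFrom x k)
∈-upFrom {x} {zero} x<y y≤x+0 =
  contradiction (ℤP.≤-trans y≤x+0 (ℤP.≤-reflexive (ℤP.+-identityʳ x))) (ℤP.<⇒≱ x<y)
∈-upFrom {x} {suc k} {y} x<y y≤x+k with y ℤ.≟ ℤ.suc x
... | yes refl = here refl
... | no y≢x+1 = there (∈-upFrom x+1<y (subst (y ≤_) (sym (suc-+-shift x k)) y≤x+k))
  where
  x+1<y = ℤP.≤∧≢⇒< (ℤP.i<j⇒suc[i]≤j x<y) (λ x+1≡y → y≢x+1 (sym x+1≡y))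

i≤+∣i∣ : ∀ i → i ≤ + ℤ.∣ i ∣
i≤+∣i∣ (+ n) = ℤP.≤-refl
i≤+∣i∣ ℤ.-[1+ n ] = ℤ.-≤+

-- the integers y with lo < y ≤ hi
range : ℤ → ℤ → List ℤ
range lo hi = Vec.toList (upFrom lo ℤ.∣ hi ℤ.- lo ∣)

∈-range : ∀ {lo hi y} → lo < y → y ≤ hi → y ∈ range lo hi
∈-range {lo} {hi} lo<y y≤hi = ∈-upFrom lo<y (ℤP.≤-trans y≤hi hi≤)
  where
  i+[j-i]≡j : ∀ i j → i ℤ.+ (j ℤ.- i) ≡ j
  i+[j-i]≡j = solve-∀
  hi≤ : hi ≤ lo ℤ.+ + ℤ.∣ hi ℤ.- lo ∣
  hi≤ = subst (_≤ lo ℤ.+ + ℤ.∣ hi ℤ.- lo ∣) (i+[j-i]≡j lo hi)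
    (ℤP.+-monoʳ-≤ lo (i≤+∣i∣ (hi ℤ.- lo)))

FlatStep? : ∀ b x y → Dec (FlatStep b x y)
FlatStep? b x y = (y ≤? b) →-dec ((y ℤ.≟ b) ⊎-dec (x ≤? ℤ.suc y))

Canonical? : ∀ b d N w → Dec (Canonical b d N w)
Canonical? b d N w = linked? (λ x y → y ≤? x) w ×-dec linked? (FlatStep? b) (ℤ.suc b ∷ w)
  ×-dec length w ℕ.≤? d ×-dec All.all? (λ y → (b ℤ.- + d <? y) ×-dec (y ≤? N)) w

canonicalWords : ℤ → ℕ → ℤ → List (List ℤ)
canonicalWords b d N = filter (Canonical? b d N) (words d (range (b ℤ.- + d) N))

∈-canonicalWords : ∀ {b d N w} → Canonical b d N w → w ∈ canonicalWords b d N
∈-canonicalWords can@(_ , _ , w≤d , bounds) =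
  ∈-filter⁺ (Canonical? _ _ _) (∈-words w≤d (All.map (λ (lo<y , y≤N) → ∈-range lo<y y≤N) bounds))
    can

∈-canonicalWords⁻ : ∀ {b d N w} → w ∈ canonicalWords b d N → Canonical b d N w
∈-canonicalWords⁻ {b} {d} {N} =
  proj₂ ∘ ∈-filter⁻ (Canonical? b d N) {xs = words d (range (b ℤ.- + d) N)}

slides-span : ∀ f → InQR f → ∃ λ L → All (λ p → Nonincreasing (proj₂ p)) L × (f ≈ₛ linComb L)
slides-span f (((d , df) , (N , sf)) , (b , qf)) =
  L , All.map proj₁ canonical ,
  agree-on-canonical (ℤP.i≤j⊔i N b) df dL sf' sL qf qL
    (λ w can → proj₂ (proj₂ solution) (∈-canonicalWords can))
  where
  N' = N ℤ.⊔ b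
  solution = triangular-solve f (canonicalWords b d N')
  L = proj₁ solution
  canonical : All (λ p → Canonical b d N' (proj₂ p)) L
  canonical = All.map ∈-canonicalWords⁻ (proj₁ (proj₂ solution))
  dL : DegreeBounded d (linComb L)
  dL w nw long = linComb-vanishes L
    (All.map (λ (_ , _ , D≤d , _) → backSlide-degreeBounded D≤d w nw long) canonical)
  sL : SupportedBelow N' (linComb L)
  sL w nw high = linComb-vanishes L
    (All.map (λ (_ , _ , _ , bounds) → backSlide-supportedBelow (All.map proj₂ bounds) w nw high) canonical)
  qL : QsymBelow b (linComb L)
  qL = linComb-qsymBelow L (All.map (λ c → proj₁ (proj₂ c)) canonical)
  sf' : SupportedBelow N' f
  sf' w nw high = sf w nw (Any.map (ℤP.≤-<-trans (ℤP.i≤i⊔j N b)) high)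

theorem4p9 :
      ((D : List ℤ) → Nonincreasing D → InQR (backSlide D))
      × ((f : Series) → InQR f →
           ∃ λ (L : List (ℚ × List ℤ)) →
             All (λ p → Nonincreasing (proj₂ p)) L × (f ≈ₛ linComb L))
      × ((L : List (ℚ × List ℤ)) →
           All (λ p → Nonincreasing (proj₂ p)) L →
           Unique (map proj₂ L) →
           linComb L ≈ₛ zeroS →
           All (λ p → proj₁ p ≡ 0ℚ) L)
-- membership holds for every word D, nonincreasing or not
theorem4p9 = (λ D _ → backSlide-inQR D) , slides-span , slides-independent
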